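{- For every signed graph $\Gamma=(G,\sigma,\mu)$, its duplication signed graph $D\Gamma$ is balanced.
   Context: A signed graph is a triple $\Gamma=(G,\sigma,\mu)$ where $G=(V,E)$ is a finite simple graph, $\sigma:E\to\{+1,-1\}$ is a signature and $\mu:V\to\{+1,-1\}$ is a marking (the paper uses the canonical marking $\mu(u)=\prod_{e\ni u}\sigma(e)$). A cycle is positive if the product of its edge signs is $+1$; a signed graph is balanced if all its cycles are positive. Duplication signed graph: if $V(\Gamma)=\{u_1,\dots,u_n\}$, take new vertices $a_1,\dots,a_n$ with marking $\mu(a_i)=\mu(u_i)$. $D\Gamma$ has vertex set $\{u_1,\dots,u_n\}\cup\{a_1,\dots,a_n\}$ and, for each edge $u_iu_j$ of $G$, an edge $a_iu_j$ with sign $\mu(a_i)\mu(u_j)$; the edges of $\Gamma$ itself are deleted, so these are the only edges. -}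

module Defs where

open import Data.Nat using (ℕ; _≤_)
open import Data.Fin using (Fin)
open import Data.Sign using (Sign) renaming (_*_ to _·_)
open import Data.Sum using (_⊎_; inj₁; inj₂)
open import Data.Product using (_×_; _,_; uncurry)
open import Data.List using (List; []; _∷_; _++_; map; foldr; length)
open import Data.List.Relation.Unary.All using (All)
open import Data.List.Relation.Unary.Unique.Propositional using (Unique)
open import Data.Empty using (⊥)
open import Relation.Nullary using (¬_)
open import Relation.Binary.PropositionalEquality using (_≡_; refl)

-- A signed graph on vertex set V: a simple graph (symmetric, irreflexive
-- adjacency), a signature σ (only its values on edges matter; it must be
-- symmetric on edges, since edges are unordered), and a marking μ.
record SignedGraph (V : Set) : Set₁ where
  field
    Adj     : V → V → Set
    Adj-sym : ∀ u v → Adj u v → Adj v u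
    Adj-irr : ∀ u → ¬ Adj u u
    σ       : V → V → Sign
    σ-sym   : ∀ u v → Adj u v → σ u v ≡ σ v u
    μ       : V → Sign

open SignedGraph public

steps : {V : Set} → V → List V → List (V × V)
steps x []       = []
steps x (y ∷ ys) = (x , y) ∷ steps y ys

cycleEdges : {V : Set} → V → List V → List (V × V)
cycleEdges v vs = steps v (vs ++ v ∷ [])

-- A cycle: distinct vertices v, v₁, …, v_k with k ≥ 2 (so length ≥ 3),
-- consecutive ones adjacent and v_k adjacent to v.
record Cycle {V : Set} (Γ : SignedGraph V) : Set where
  field
    start    : V
    rest     : List V
    long     : 2 ≤ length rest
    distinct : Unique (start ∷ rest)
    edges    : All (uncurry (Adj Γ)) (cycleEdges start rest)

cycleSign : {V : Set} (Γ : SignedGraph V) → Cycle Γ → Sign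
cycleSign Γ C = foldr _·_ Sign.+ (map (uncurry (σ Γ)) (cycleEdges (Cycle.start C) (Cycle.rest C)))

Balanced : {V : Set} → SignedGraph V → Set
Balanced Γ = (C : Cycle Γ) → cycleSign Γ C ≡ Sign.+

-- Duplication signed graph: vertices inj₁ i = u_i (original), inj₂ i = a_i (new).
DAdj : {V : Set} → SignedGraph V → V ⊎ V → V ⊎ V → Set
DAdj Γ (inj₁ x) (inj₁ y) = ⊥
DAdj Γ (inj₁ j) (inj₂ i) = Adj Γ i j
DAdj Γ (inj₂ i) (inj₁ j) = Adj Γ i j
DAdj Γ (inj₂ x) (inj₂ y) = ⊥

Dσ : {V : Set} → SignedGraph V → V ⊎ V → V ⊎ V → Sign
Dσ Γ (inj₁ j) (inj₂ i) = μ Γ i · μ Γ j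
Dσ Γ (inj₂ i) (inj₁ j) = μ Γ i · μ Γ j
Dσ Γ _ _ = Sign.+

Dμ : {V : Set} → SignedGraph V → V ⊎ V → Sign
Dμ Γ (inj₁ i) = μ Γ i
Dμ Γ (inj₂ i) = μ Γ i

DAdj-sym : {V : Set} (Γ : SignedGraph V) → ∀ u v → DAdj Γ u v → DAdj Γ v u
DAdj-sym Γ (inj₁ j) (inj₂ i) p = p
DAdj-sym Γ (inj₂ i) (inj₁ j) p = p

DAdj-irr : {V : Set} (Γ : SignedGraph V) → ∀ u → ¬ DAdj Γ u u
DAdj-irr Γ (inj₁ x) ()
DAdj-irr Γ (inj₂ x) ()

Dσ-sym : {V : Set} (Γ : SignedGraph V) → ∀ u v → DAdj Γ u v → Dσ Γ u v ≡ Dσ Γ v u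
Dσ-sym Γ (inj₁ j) (inj₂ i) _ = refl
Dσ-sym Γ (inj₂ i) (inj₁ j) _ = refl

D : {V : Set} → SignedGraph V → SignedGraph (V ⊎ V)
D Γ = record
  { Adj = DAdj Γ ; Adj-sym = DAdj-sym Γ ; Adj-irr = DAdj-irr Γ
  ; σ = Dσ Γ ; σ-sym = Dσ-sym Γ ; μ = Dμ Γ }

{-# OPTIONS --safe #-}
module Submission where

-- If every edge uv is signed μ(u)μ(v), the signs along a walk telescope to
-- μ(start)μ(end); on a closed walk this is μ(v)² = +. Edges of DΓ are
-- signed exactly this way.

open import Defs
open import Data.Nat using (ℕ)
open import Data.Fin using (Fin)
open import Data.Sign using (Sign) renaming (_*_ to _·_)
open import Data.Sign.Properties using (*-assoc; *-comm; *-identityˡ; *-identityʳ; s*s≡+)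
open import Data.Sum using (inj₁; inj₂)
open import Data.Product using (uncurry)
open import Data.List using ([]; _∷_; _++_; map; foldr)
open import Data.List.Relation.Unary.All using (All; _∷_)
open import Relation.Binary.PropositionalEquality using (_≡_; refl; cong; cong₂; trans; module ≡-Reasoning)

·-telescope : ∀ a b c → (a · b) · (b · c) ≡ a · c
·-telescope a b c = begin
  (a · b) · (b · c)  ≡⟨ *-assoc a b (b · c) ⟩
  a · (b · (b · c))  ≡⟨ cong (a ·_) (*-assoc b b c) ⟨
  a · ((b · b) · c)  ≡⟨ cong (λ s → a · (s · c)) (s*s≡+ b) ⟩
  a · (Sign.+ · c)   ≡⟨ cong (a ·_) (*-identityˡ c) ⟩
  a · c              ∎
  where open ≡-Reasoning

module _ {V : Set} (Γ : SignedGraph V)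
         (σ≡μ·μ : ∀ u v → Adj Γ u v → σ Γ u v ≡ μ Γ u · μ Γ v) where

  walkSign : ∀ x ys z → All (uncurry (Adj Γ)) (steps x (ys ++ z ∷ [])) →
             foldr _·_ Sign.+ (map (uncurry (σ Γ)) (steps x (ys ++ z ∷ []))) ≡ μ Γ x · μ Γ z
  walkSign x []       z (xz ∷ _)  = trans (*-identityʳ _) (σ≡μ·μ x z xz)
  walkSign x (y ∷ ys) z (xy ∷ ps) =
    trans (cong₂ _·_ (σ≡μ·μ x y xy) (walkSign y ys z ps))
          (·-telescope (μ Γ x) (μ Γ y) (μ Γ z))

  balanced-if-σ≡μ·μ : Balanced Γ
  balanced-if-σ≡μ·μ C = trans (walkSign v (Cycle.rest C) v (Cycle.edges C)) (s*s≡+ (μ Γ v))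
    where v = Cycle.start C

D-σ≡μ·μ : {V : Set} (Γ : SignedGraph V) → ∀ u v → Adj (D Γ) u v → σ (D Γ) u v ≡ μ (D Γ) u · μ (D Γ) v
D-σ≡μ·μ Γ (inj₁ j) (inj₂ i) _ = *-comm (μ Γ i) (μ Γ j)
D-σ≡μ·μ Γ (inj₂ i) (inj₁ j) _ = refl

mainTheorem2 : (n : ℕ) (Γ : SignedGraph (Fin n)) → Balanced (D Γ)
mainTheorem2 n Γ = balanced-if-σ≡μ·μ (D Γ) (D-σ≡μ·μ Γ)
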